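{- Let $T$ be an irreducible triangulation of a closed surface other than the sphere $S_0$, and let $v$ be a vertex of $T$. Then there exist two nonseparating 3-cycles $v v_i v_k$ and $v v_j v_l$ in $T$ such that $v_i$, $v_j$, $v_k$, $v_l$ are four distinct vertices, and, of the two paths from $v_i$ to $v_k$ in $\mathrm{lk}(v)$, one contains $v_j$ and the other contains $v_l$.
   Context: A triangulation of a closed surface is a simple graph embedded in the surface such that each face is a triangle and any two faces share at most one edge. For an edge $ac$ with incident faces $abc$ and $acd$, the contraction of $ac$ deletes $ac$, identifies $a$ and $c$, and removes one of each pair of resulting multiple edges ($ab$/$cb$ and $ad$/$cd$). An edge is contractible if its contraction yields a triangulation of the same surface; for triangulations other than $K_4$ on the sphere, an edge is non-contractible iff it lies on at least three 3-cycles (i.e. on some non-facial 3-cycle). A triangulation is irreducible if it has no contractible edges. The link $\mathrm{lk}(v)$ of a vertex $v$ is the cycle through the neighbours of $v$ formed by the edges of the faces incident to $v$ opposite $v$. A 3-cycle $abc$, embedded as a closed curve $C$ in the surface $S$, is separating if $S - C$ is disconnected and nonseparating otherwise. -}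

module Defs where

open import Data.Nat using (ℕ; zero; suc)
open import Data.Bool using (Bool; true; false; _∧_; if_then_else_)
open import Data.Fin using (Fin; _<?_)
open import Data.Fin.Properties using () renaming (_≟_ to _≟ᶠ_)
open import Data.List using (List; []; _∷_; length; lookup; allFin; concatMap; map)
open import Data.Bool.ListAction using (any)
open import Data.Nat.ListAction using (sum)
open import Data.List.Membership.Propositional using (_∈_)
open import Data.List.Relation.Unary.All using (All)
open import Data.List.Relation.Unary.Unique.Propositional using (Unique)
open import Data.Product using (Σ; ∃; ∃-syntax; _×_; _,_)
open import Data.Sum using (_⊎_)
open import Data.Integer using (ℤ; +_; _-_) renaming (_+_ to _+ℤ_)
open import Relation.Nullary using (¬_; Dec; yes; no)
open import Relation.Nullary.Decidable using (⌊_⌋)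
open import Relation.Binary.PropositionalEquality using (_≡_; _≢_)
open import Relation.Binary.Construct.Closure.ReflexiveTransitive using (Star)

-- A face is an (unordered) triple of vertices, stored as an ordered triple.
Tri : ℕ → Set
Tri n = Fin n × Fin n × Fin n

module _ {n : ℕ} (faces : List (Tri n)) where

  _∈t_ : Fin n → Tri n → Set
  x ∈t (a , b , c) = x ≡ a ⊎ x ≡ b ⊎ x ≡ c

  FaceIx : Set
  FaceIx = Fin (length faces)

  face : FaceIx → Tri n
  face i = lookup faces i

  IsFace : Fin n → Fin n → Fin n → Set
  IsFace a b c = a ≢ b × b ≢ c × a ≢ c ×
    ∃[ i ] (a ∈t face i × b ∈t face i × c ∈t face i)

  Adj : Fin n → Fin n → Set
  Adj a b = a ≢ b × ∃[ i ] (a ∈t face i × b ∈t face i)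

  DistinctCorners : Tri n → Set
  DistinctCorners (a , b , c) = a ≢ b × b ≢ c × a ≢ c

  record IsTriangulation : Set where
    field
      nonempty       : ∃[ t ] (t ∈ faces)
      corners        : All DistinctCorners faces
      shareAtMostOneEdge : (i j : FaceIx) → i ≢ j →
        ¬ (∀ x → x ∈t face i → x ∈t face j)
      edgeTwoFaces   : ∀ a b → Adj a b →
        ∃[ i ] ∃[ j ] (i ≢ j ×
          (a ∈t face i × b ∈t face i) × (a ∈t face j × b ∈t face j) ×
          (∀ k → a ∈t face k → b ∈t face k → k ≡ i ⊎ k ≡ j))
      vertexUsed     : ∀ v → ∃[ i ] (v ∈t face i)
      -- the link of every vertex is a single cycle (it is a disjoint union of
      -- cycles by edgeTwoFaces; we require it to be connected)
      linkConnected  : ∀ v x y → Adj v x → Adj v y →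
        Star (λ p q → IsFace v p q) x y
      connected      : ∀ a b → Star Adj a b

  _∈tᵇ_ : Fin n → Tri n → Bool
  x ∈tᵇ (a , b , c) = ⌊ x ≟ᶠ a ⌋ Data.Bool.∨ ⌊ x ≟ᶠ b ⌋ Data.Bool.∨ ⌊ x ≟ᶠ c ⌋

  edgeᵇ : Fin n → Fin n → Bool
  edgeᵇ a b = ⌊ a <? b ⌋ ∧ any (λ t → (a ∈tᵇ t) ∧ (b ∈tᵇ t)) faces

  numEdges : ℕ
  numEdges = sum (concatMap (λ a → map (λ b → if edgeᵇ a b then 1 else 0) (allFin n)) (allFin n))

  eulerChar : ℤ
  eulerChar = (+ n - + numEdges) +ℤ + length faces

  -- the surface is not the sphere S₀ (closed connected surfaces with χ = 2
  -- are exactly the spheres)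
  NotSphere : Set
  NotSphere = eulerChar ≢ + 2

  -- Irreducibility: no contractible edges, i.e. every edge lies on a
  -- non-facial 3-cycle (criterion from the paper's context).
  Irreducible : Set
  Irreducible = ∀ a b → Adj a b →
    ∃[ c ] (Adj a c × Adj b c × ¬ IsFace a b c)

  -- Nonseparating 3-cycles.  S - C is connected iff the faces are
  -- connected through steps across edges not lying on C.
  OnCycle : Fin n → Fin n → Fin n → Fin n → Set
  OnCycle a b c x = x ≡ a ⊎ x ≡ b ⊎ x ≡ c

  FaceStep : Fin n → Fin n → Fin n → FaceIx → FaceIx → Set
  FaceStep a b c i j = ∃[ x ] ∃[ y ] (x ≢ y ×
    x ∈t face i × y ∈t face i × x ∈t face j × y ∈t face j ×
    ¬ (OnCycle a b c x × OnCycle a b c y))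

  ThreeCycle : Fin n → Fin n → Fin n → Set
  ThreeCycle a b c = Adj a b × Adj b c × Adj a c

  NonseparatingThreeCycle : Fin n → Fin n → Fin n → Set
  NonseparatingThreeCycle a b c = ThreeCycle a b c ×
    (∀ i j → Star (FaceStep a b c) i j)

  -- Paths in the link lk(v): the link graph has an edge xy iff vxy is a face.
  data Walk (R : Fin n → Fin n → Set) : Fin n → Fin n → List (Fin n) → Set where
    here : ∀ {x} → Walk R x x (x ∷ [])
    step : ∀ {x y z zs} → R x z → Walk R z y zs → Walk R x y (x ∷ zs)

  LinkPath : Fin n → Fin n → Fin n → List (Fin n) → Set
  LinkPath v x y P = Walk (λ p q → IsFace v p q) x y P × Unique P

{-# OPTIONS --safe #-}
module Submission where

-- The link lk(v) is a cycle.  By irreducibility, for a neighbour a of v there is a non-facial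
-- triangle vab, and a, b cut lk(v) into two arcs.  Let w follow a on one of them and let vwc be a
-- non-facial triangle.  If c lies on the same arc, recurse on the shorter arc from w to c;
-- otherwise a, w, b, c alternate around lk(v), and then both vab and vwc are nonseparating.
-- For vab: from a face at the chord wc, all faces around a vertex off the triangle are reached
-- without crossing it, so walking along both arcs of lk(v) from w and from c reaches both faces
-- at va and both at vb; hence all faces at v, then all faces at a (going around lk(a) without
-- passing b), and now every edge can be crossed, so connectedness reaches every face.

open import Defs
open import Data.Nat using (ℕ; zero; suc; _+_; _≤_; s≤s; z≤n)
open import Data.Nat.Properties using (≤-refl; ≤-trans; <-irrefl; +-identityʳ; +-suc; m≤n+m; ≤-<-connex)
open import Data.Fin using (Fin; zero; suc)
open import Data.Fin.Properties using (_≟_; pigeonhole)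
import Data.Fin.Properties as Fin
open import Data.List using (List; []; _∷_; _++_; _∷ʳ_; length; lookup; reverse)
open import Data.List.Properties using (unfold-reverse)
open import Data.List.Membership.Propositional using (_∈_; _∉_)
open import Data.List.Membership.Propositional.Properties using (∈-lookup; ∈-++⁺ˡ; ∈-++⁺ʳ; ∈-++⁻)
open import Data.List.Relation.Binary.Subset.Propositional using (_⊆_)
open import Data.List.Relation.Unary.Any using (here; there; any?)
open import Data.List.Relation.Unary.Any.Properties using (reverse⁺; reverse⁻)
open import Data.List.Relation.Unary.All as All using ([]; _∷_)
open import Data.List.Relation.Unary.All.Properties using (¬Any⇒All¬)
open import Data.List.Relation.Unary.AllPairs as AllPairs using ([]; _∷_)
open import Data.List.Relation.Unary.Unique.Propositional using (Unique)
open import Data.List.Relation.Unary.Unique.Propositional.Properties using (Unique[x∷xs]⇒x∉xs)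
open import Data.List.Relation.Binary.Permutation.Propositional using (↭⇒↭ₛ; ↭-sym)
open import Data.List.Relation.Binary.Permutation.Propositional.Properties using (↭-reverse)
import Data.List.Relation.Binary.Permutation.Setoid.Properties as PermutationSetoid
open import Data.Product using (∃-syntax; _×_; _,_; proj₁; proj₂)
open import Data.Sum using (_⊎_; inj₁; inj₂; [_,_])
import Data.Sum as Sum
open import Data.Empty using (⊥; ⊥-elim)
open import Function using (_∘_; id)
open import Relation.Nullary using (¬_; Dec; yes; no)
open import Relation.Nullary.Decidable using (_⊎-dec_)
open import Relation.Binary.PropositionalEquality using (_≡_; _≢_; refl; sym; cong; subst; setoid; ≢-sym)
open import Relation.Binary.Construct.Closure.ReflexiveTransitive using (Star; ε; _◅_; _◅◅_)
import Relation.Binary.Construct.Closure.ReflexiveTransitive as Star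

Unique-reverse : ∀ {A : Set} {xs : List A} → Unique xs → Unique (reverse xs)
Unique-reverse {A} {xs} = PermutationSetoid.Unique-resp-↭ (setoid A) (↭⇒↭ₛ (↭-sym (↭-reverse xs)))

Unique-++ˡ : ∀ {A : Set} (xs : List A) {ys} → Unique (xs ++ ys) → Unique xs
Unique-++ˡ []       _          = []
Unique-++ˡ (x ∷ xs) (x∉ ∷ xs!) = All.tabulate (All.lookup x∉ ∘ ∈-++⁺ˡ) ∷ Unique-++ˡ xs xs!

Unique-++-disjoint : ∀ {A : Set} (xs : List A) {ys u} → Unique (xs ++ ys) → u ∈ xs → u ∉ ys
Unique-++-disjoint (x ∷ xs) (x∉ ∷ _)  (here refl) u∈ys = All.lookup x∉ (∈-++⁺ʳ xs u∈ys) refl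
Unique-++-disjoint (x ∷ xs) (_ ∷ xs!) (there u∈xs) u∈ys = Unique-++-disjoint xs xs! u∈xs u∈ys

lookup-injective : ∀ {A : Set} {xs : List A} → Unique xs → ∀ i j → lookup xs i ≡ lookup xs j → i ≡ j
lookup-injective {xs = _ ∷ _} _         zero    zero    _ = refl
lookup-injective {xs = _ ∷ _} (x∉ ∷ _)  zero    (suc j) e = ⊥-elim (All.lookup x∉ (∈-lookup j) e)
lookup-injective {xs = _ ∷ _} (x∉ ∷ _)  (suc i) zero    e = ⊥-elim (All.lookup x∉ (∈-lookup i) (sym e))
lookup-injective {xs = _ ∷ _} (_ ∷ xs!) (suc i) (suc j) e = cong suc (lookup-injective xs! i j e)

Unique-length : ∀ {n} {xs : List (Fin n)} → Unique xs → length xs ≤ n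
Unique-length {n} {xs} xs! with ≤-<-connex (length xs) n
... | inj₁ ≤n = ≤n
... | inj₂ n< with pigeonhole n< (lookup xs)
... | i , j , i<j , e = ⊥-elim (Fin.<-irrefl (lookup-injective xs! i j e) i<j)

Star-preserves : ∀ {A : Set} {R : A → A → Set} (P : A → Set) →
                 (∀ {p q} → R p q → P p → P q) → ∀ {s t} → Star R s t → P s → P t
Star-preserves P preserve = Star.foldl (λ p q → P p → P q) (λ f r → preserve r ∘ f) id

no-three-distinct-in-pair : ∀ {A : Set} {b c x y z : A} →
  x ≡ b ⊎ x ≡ c → y ≡ b ⊎ y ≡ c → z ≡ b ⊎ z ≡ c → x ≢ y → y ≢ z → x ≢ z → ⊥
no-three-distinct-in-pair (inj₁ refl) (inj₁ refl) _           x≢y _   _   = x≢y refl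
no-three-distinct-in-pair (inj₂ refl) (inj₂ refl) _           x≢y _   _   = x≢y refl
no-three-distinct-in-pair (inj₁ refl) (inj₂ refl) (inj₁ refl) _   _   x≢z = x≢z refl
no-three-distinct-in-pair (inj₁ refl) (inj₂ refl) (inj₂ refl) _   y≢z _   = y≢z refl
no-three-distinct-in-pair (inj₂ refl) (inj₁ refl) (inj₁ refl) _   y≢z _   = y≢z refl
no-three-distinct-in-pair (inj₂ refl) (inj₁ refl) (inj₂ refl) _   _   x≢z = x≢z refl

-- Walk lives in the module of Defs parametrised by the face list, which it never uses.
module _ {n : ℕ} {faces : List (Tri n)} {R : Fin n → Fin n → Set} where

  source∈ : ∀ {s t L} → Walk faces R s t L → s ∈ L
  source∈ here       = here refl
  source∈ (step _ _) = here refl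

  target∈ : ∀ {s t L} → Walk faces R s t L → t ∈ L
  target∈ here       = here refl
  target∈ (step _ w) = there (target∈ w)

  last-step : ∀ {s s₂ t M} → R s s₂ → Walk faces R s₂ t M → ∃[ t′ ] (t′ ∈ s ∷ M × R t′ t)
  last-step {s} r here = s , here refl , r
  last-step r (step r′ w) with last-step r′ w
  ... | t′ , t′∈ , r″ = t′ , there t′∈ , r″

  walk-preserves : ∀ {s t L} (P : Fin n → Set) → (∀ {p r} → r ∈ L → R p r → P p → P r) →
                   Walk faces R s t L → P s → P t
  walk-preserves P preserve here       Ps = Ps
  walk-preserves P preserve (step r w) Ps =
    walk-preserves P (preserve ∘ there) w (preserve (there (source∈ w)) r Ps)

  walk-reflects : ∀ {s t L} (P : Fin n → Set) → (∀ {p r} → p ∈ L → R p r → P r → P p) →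
                  Walk faces R s t L → P t → P s
  walk-reflects P reflect here       Pt = Pt
  walk-reflects P reflect (step r w) Pt = reflect (here refl) r (walk-reflects P (reflect ∘ there) w Pt)

  snoc-walk : ∀ {s t u L} → Walk faces R s t L → R t u → Walk faces R s u (L ∷ʳ u)
  snoc-walk here        r = step r here
  snoc-walk (step r′ w) r = step r′ (snoc-walk w r)

  reverse-walk : (∀ {p q} → R p q → R q p) → ∀ {s t L} → Walk faces R s t L → Walk faces R t s (reverse L)
  reverse-walk R-sym here = here
  reverse-walk R-sym (step {x = s} {zs = L} r w) =
    subst (Walk faces R _ s) (sym (unfold-reverse s L)) (snoc-walk (reverse-walk R-sym w) (R-sym r))

  record Split (s t c : Fin n) (L : List (Fin n)) : Set where
    field
      prefix suffix : List (Fin n)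
      prefix-walk   : Walk faces R s c prefix
      suffix-walk   : Walk faces R c t suffix
      prefix⊆       : prefix ⊆ L
      suffix⊆       : suffix ⊆ L
      covers        : ∀ {u} → u ∈ L → u ∈ prefix ⊎ u ∈ suffix
      prefix-length : length prefix ≤ length L
      unique-prefix : Unique L → Unique prefix
      unique-suffix : Unique L → Unique suffix
      meet          : Unique L → ∀ {u} → u ∈ prefix → u ∈ suffix → u ≡ c

  split-at-source : ∀ {s t L} → Walk faces R s t (s ∷ L) → Split s t s (s ∷ L)
  split-at-source {s} {L = L} w = record
    { prefix        = s ∷ []
    ; suffix        = s ∷ L
    ; prefix-walk   = here
    ; suffix-walk   = w
    ; prefix⊆       = λ { (here refl) → here refl }
    ; suffix⊆       = id
    ; covers        = inj₂
    ; prefix-length = s≤s z≤n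
    ; unique-prefix = λ _ → [] ∷ []
    ; unique-suffix = id
    ; meet          = λ { _ (here refl) _ → refl }
    }

  split : ∀ {s t c L} → Walk faces R s t L → c ∈ L → Split s t c L
  split w@here       (here refl) = split-at-source w
  split w@(step _ _) (here refl) = split-at-source w
  split (step {x = s} r w) (there c∈) = record
    { prefix        = s ∷ S.prefix
    ; suffix        = S.suffix
    ; prefix-walk   = step r S.prefix-walk
    ; suffix-walk   = S.suffix-walk
    ; prefix⊆       = λ { (here refl) → here refl ; (there u∈) → there (S.prefix⊆ u∈) }
    ; suffix⊆       = there ∘ S.suffix⊆
    ; covers        = λ { (here refl) → inj₁ (here refl) ; (there u∈) → Sum.map₁ there (S.covers u∈) }
    ; prefix-length = s≤s S.prefix-length
    ; unique-prefix = λ { (s∉ ∷ L!) → All.tabulate (All.lookup s∉ ∘ S.prefix⊆) ∷ S.unique-prefix L! }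
    ; unique-suffix = λ { (_ ∷ L!) → S.unique-suffix L! }
    ; meet          = λ { (s∉ ∷ _) (here refl) u∈ → ⊥-elim (All.lookup s∉ (S.suffix⊆ u∈) refl)
                        ; (_ ∷ L!) (there u∈) u∈′ → S.meet L! u∈ u∈′ }
    }
    where module S = Split (split w c∈)

  walk-between : (∀ {p q} → R p q → R q p) → ∀ {a b s t L} → Walk faces R a b L → s ∈ L → t ∈ L →
                 ∃[ M ] (Walk faces R s t M × M ⊆ L)
  walk-between R-sym w s∈ t∈ with split w s∈
  ... | S with Split.covers S t∈
  ... | inj₂ t∈suffix = let module T = Split (split (Split.suffix-walk S) t∈suffix) in
                        T.prefix , T.prefix-walk , Split.suffix⊆ S ∘ T.prefix⊆
  ... | inj₁ t∈prefix = let s⇝a = reverse-walk R-sym (Split.prefix-walk S)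
                            module T = Split (split s⇝a (reverse⁺ t∈prefix)) in
                        T.prefix , T.prefix-walk , Split.prefix⊆ S ∘ reverse⁻ ∘ T.prefix⊆

  loop-erase : ∀ {s t} → Star R s t → ∃[ L ] (Walk faces R s t L × Unique L)
  loop-erase ε = _ , here , [] ∷ []
  loop-erase {s} (r ◅ rs) with loop-erase rs
  ... | M , w , M! with any? (s ≟_) M
  ... | yes s∈ = Split.suffix S , Split.suffix-walk S , Split.unique-suffix S M!
    where S = split w s∈
  ... | no s∉  = s ∷ M , step r w , ¬Any⇒All¬ M s∉ ∷ M!

module CycleGraph {n : ℕ} {faces : List (Tri n)}
  (E : Fin n → Fin n → Set) (D : Fin n → Set)
  (E-sym       : ∀ {p q} → E p q → E q p)
  (E-irrefl    : ∀ {p q} → E p q → p ≢ q)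
  (E-dom       : ∀ {p q} → E p q → D p)
  (at-most-two : ∀ {u p q r} → E u p → E u q → E u r → p ≢ q → r ≡ p ⊎ r ≡ q)
  (another     : ∀ {u p} → E u p → ∃[ q ] (q ≢ p × E u q))
  (connected   : ∀ {p q} → D p → D q → Star E p q)
  where

  Path : Fin n → Fin n → List (Fin n) → Set
  Path = Walk faces E

  interior-neighbour : ∀ {s t L u r} → Path s t L → Unique L → u ∈ L → u ≢ s → u ≢ t → E u r → r ∈ L
  interior-neighbour here       _ (here refl) _   u≢t _ = ⊥-elim (u≢t refl)
  interior-neighbour (step _ _) _ (here refl) u≢s _   _ = ⊥-elim (u≢s refl)
  interior-neighbour {u = u} (step {z = s₂} _ w) (_ ∷ L!) (there u∈) _ u≢t eur with u ≟ s₂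
  ... | no u≢s₂ = there (interior-neighbour w L! u∈ u≢s₂ u≢t eur)
  interior-neighbour (step _ here) _ _ _ u≢t _ | yes refl = ⊥-elim (u≢t refl)
  interior-neighbour (step e (step e′ w)) (s∉ ∷ _) _ _ _ eur | yes refl
    with at-most-two (E-sym e) e′ eur (All.lookup s∉ (there (source∈ w)))
  ... | inj₁ refl = here refl
  ... | inj₂ refl = there (there (source∈ w))

  -- The closed walk s s₂ … t s; s₂ ≢ t excludes the degenerate s t s.
  cycle-covers : ∀ {s s₂ t M} → E s s₂ → Path s₂ t M → Unique (s ∷ M) → s₂ ≢ t → E t s →
                 ∀ {u} → D u → u ∈ s ∷ M
  cycle-covers {s} {t = t} {M} e w L! s₂≢t ets du =
    Star-preserves (_∈ s ∷ M) closed (connected (E-dom e) du) (here refl)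
    where
    predecessor : ∀ {s′ M′} → Path s′ t M′ → s ∉ M′ → s′ ≢ t →
                  ∃[ t′ ] (t′ ∈ M′ × t′ ≢ s × E t′ t)
    predecessor here         _  s′≢t = ⊥-elim (s′≢t refl)
    predecessor (step e′ w′) s∉ _ with last-step e′ w′
    ... | t′ , t′∈ , et′t = t′ , t′∈ , (λ t′≡s → s∉ (subst (_∈ _) t′≡s t′∈)) , et′t

    closed : ∀ {p r} → E p r → p ∈ s ∷ M → r ∈ s ∷ M
    closed {p} epr p∈ with p ≟ s | p ≟ t
    ... | yes refl | _ with at-most-two e (E-sym ets) epr s₂≢t
    ...   | inj₁ refl = there (source∈ w)
    ...   | inj₂ refl = there (target∈ w)
    closed {p} epr p∈ | no _ | yes refl with predecessor w (Unique[x∷xs]⇒x∉xs L!) s₂≢t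
    ...   | t′ , t′∈ , t′≢s , et′t with at-most-two (E-sym et′t) ets epr t′≢s
    ...     | inj₁ refl = there t′∈
    ...     | inj₂ refl = here refl
    closed epr p∈ | no p≢s | no p≢t = interior-neighbour (step e w) L! p∈ p≢s p≢t epr

  complementary-arc : ∀ {a b L} → Path a b L → Unique L → a ≢ b →
    ∃[ L′ ] (Path a b L′ × Unique L′ × (∀ {u} → u ∈ L → u ∈ L′ → u ≡ a ⊎ u ≡ b) ×
             (∀ {u} → D u → u ∈ L ⊎ u ∈ L′))
  complementary-arc here _ a≢b = ⊥-elim (a≢b refl)
  complementary-arc {a} {b} (step {zs = W} e₀ w₀) L! a≢b = grow n (m≤n+m n _) here e₀ w₀ refl L!
    where
    Arc : Set
    Arc = ∃[ L′ ] (Path a b L′ × Unique L′ × (∀ {u} → u ∈ a ∷ W → u ∈ L′ → u ≡ a ⊎ u ≡ b) ×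
                   (∀ {u} → D u → u ∈ a ∷ W ⊎ u ∈ L′))

    -- The new arc grows backwards from a: back is its part c ⇝ a built so far, and c s … b is that
    -- part followed by the old arc.  All these vertices are distinct, so n steps of fuel suffice.
    grow : (fuel : ℕ) → ∀ {c s M Lc} → n ≤ length (c ∷ M) + fuel →
           Path c a Lc → E c s → Path s b M → c ∷ M ≡ Lc ++ W → Unique (c ∷ M) → Arc
    grow fuel {c} {M = M} {Lc} bound back ecs forward eq cM! with another ecs
    ... | z , z≢s , ecz with z ≟ b
    ... | yes refl = reverse (b ∷ Lc) , reverse-walk E-sym (step (E-sym ecz) back) , Unique-reverse bLc! ,
                     (λ u∈ u∈′ → meet u∈ (reverse⁻ u∈′)) , covers
      where
      LcW! : Unique (Lc ++ W)
      LcW! = subst Unique eq cM!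

      bLc! : Unique (b ∷ Lc)
      bLc! = ¬Any⇒All¬ Lc (λ b∈ → Unique-++-disjoint Lc LcW! b∈ (target∈ w₀)) ∷ Unique-++ˡ Lc LcW!

      meet : ∀ {u} → u ∈ a ∷ W → u ∈ b ∷ Lc → u ≡ a ⊎ u ≡ b
      meet (here refl) _           = inj₁ refl
      meet (there _)   (here refl) = inj₂ refl
      meet (there u∈W) (there u∈Lc) = ⊥-elim (Unique-++-disjoint Lc LcW! u∈Lc u∈W)

      covers : ∀ {u} → D u → u ∈ a ∷ W ⊎ u ∈ reverse (b ∷ Lc)
      covers du with ∈-++⁻ Lc (subst (_ ∈_) eq (cycle-covers ecs forward cM! (≢-sym z≢s) (E-sym ecz) du))
      ... | inj₁ u∈Lc = inj₂ (reverse⁺ (there u∈Lc))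
      ... | inj₂ u∈W  = inj₁ (there u∈W)
    ... | no z≢b = continue fuel bound
      where
      z∉ : z ∉ c ∷ M
      z∉ (here z≡c) = E-irrefl ecz (sym z≡c)
      z∉ (there z∈) = Unique[x∷xs]⇒x∉xs cM!
                        (interior-neighbour forward (AllPairs.tail cM!) z∈ z≢s z≢b (E-sym ecz))

      zcM! : Unique (z ∷ c ∷ M)
      zcM! = ¬Any⇒All¬ (c ∷ M) z∉ ∷ cM!

      continue : (fuel : ℕ) → n ≤ length (c ∷ M) + fuel → Arc
      continue zero    bound =
        ⊥-elim (<-irrefl refl (≤-trans (Unique-length zcM!) (subst (n ≤_) (+-identityʳ _) bound)))
      continue (suc k) bound = grow k (subst (n ≤_) (+-suc _ k) bound) (step (E-sym ecz) back) (E-sym ecz)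
                                    (step ecs forward) (cong (z ∷_) eq) zcM!

  avoiding-walk : ∀ {y y₁ s t} → E y y₁ → D s → D t → s ≢ y → t ≢ y → ∃[ L ] (Path s t L × y ∉ L)
  avoiding-walk {y} {y₁} e₁ ds dt s≢y t≢y with another e₁
  ... | y₂ , y₂≢y₁ , e₂
    with complementary-arc (step (E-sym e₁) (step e₂ here)) y₁yy₂! (≢-sym y₂≢y₁)
    where
    y₁yy₂! : Unique (y₁ ∷ y ∷ y₂ ∷ [])
    y₁yy₂! = (≢-sym (E-irrefl e₁) ∷ ≢-sym y₂≢y₁ ∷ []) ∷ (E-irrefl e₂ ∷ []) ∷ [] ∷ []
  ... | L , arc , _ , meet , covers =
    let M , walk , M⊆L = walk-between E-sym arc (on-arc ds s≢y) (on-arc dt t≢y) in M , walk , y∉L ∘ M⊆L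
    where
    y∉L : y ∉ L
    y∉L y∈ with meet (there (here refl)) y∈
    ... | inj₁ y≡y₁ = E-irrefl e₁ y≡y₁
    ... | inj₂ y≡y₂ = E-irrefl e₂ y≡y₂

    on-arc : ∀ {u} → D u → u ≢ y → u ∈ L
    on-arc du u≢y with covers du
    ... | inj₂ u∈L                         = u∈L
    ... | inj₁ (here refl)                 = source∈ arc
    ... | inj₁ (there (here u≡y))          = ⊥-elim (u≢y u≡y)
    ... | inj₁ (there (there (here refl))) = target∈ arc

module Corners {n : ℕ} (faces : List (Tri n)) where
  private
    infix 4 _∈ᵗ_
    _∈ᵗ_ : Fin n → Tri n → Set
    _∈ᵗ_ = _∈t_ faces

    drop₁ : ∀ {a b c x} → x ∈ᵗ (a , b , c) → a ≢ x → x ≡ b ⊎ x ≡ c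
    drop₁ (inj₁ refl) a≢x = ⊥-elim (a≢x refl)
    drop₁ (inj₂ x∈bc) _   = x∈bc

    drop₂ : ∀ {a b c x} → x ∈ᵗ (a , b , c) → b ≢ x → x ≡ a ⊎ x ≡ c
    drop₂ (inj₁ x≡a)        _   = inj₁ x≡a
    drop₂ (inj₂ (inj₁ refl)) b≢x = ⊥-elim (b≢x refl)
    drop₂ (inj₂ (inj₂ x≡c)) _   = inj₂ x≡c

    drop₃ : ∀ {a b c x} → x ∈ᵗ (a , b , c) → c ≢ x → x ≡ a ⊎ x ≡ b
    drop₃ (inj₁ x≡a)        _   = inj₁ x≡a
    drop₃ (inj₂ (inj₁ x≡b)) _   = inj₂ x≡b
    drop₃ (inj₂ (inj₂ refl)) c≢x = ⊥-elim (c≢x refl)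

    avoids? : (x z u : Fin n) → (x ≢ z × x ≢ u) ⊎ (x ≡ z ⊎ x ≡ u)
    avoids? x z u with x ≟ z | x ≟ u
    ... | yes x≡z | _       = inj₂ (inj₁ x≡z)
    ... | no _    | yes x≡u = inj₂ (inj₂ x≡u)
    ... | no x≢z  | no x≢u  = inj₁ (x≢z , x≢u)

  no-four-corners : ∀ {t p q r s} → p ∈ᵗ t → q ∈ᵗ t → r ∈ᵗ t → s ∈ᵗ t →
                    p ≢ q → p ≢ r → p ≢ s → q ≢ r → q ≢ s → r ≢ s → ⊥
  no-four-corners (inj₁ refl)        q∈ r∈ s∈ p≢q p≢r p≢s q≢r q≢s r≢s =
    no-three-distinct-in-pair (drop₁ q∈ p≢q) (drop₁ r∈ p≢r) (drop₁ s∈ p≢s) q≢r r≢s q≢s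
  no-four-corners (inj₂ (inj₁ refl)) q∈ r∈ s∈ p≢q p≢r p≢s q≢r q≢s r≢s =
    no-three-distinct-in-pair (drop₂ q∈ p≢q) (drop₂ r∈ p≢r) (drop₂ s∈ p≢s) q≢r r≢s q≢s
  no-four-corners (inj₂ (inj₂ refl)) q∈ r∈ s∈ p≢q p≢r p≢s q≢r q≢s r≢s =
    no-three-distinct-in-pair (drop₃ q∈ p≢q) (drop₃ r∈ p≢r) (drop₃ s∈ p≢s) q≢r r≢s q≢s

  fourth-corner-repeats : ∀ {t z u p r} → z ∈ᵗ t → u ∈ᵗ t → p ∈ᵗ t → r ∈ᵗ t →
                          z ≢ u → z ≢ p → u ≢ p → r ≢ z → r ≢ u → r ≡ p
  fourth-corner-repeats {p = p} {r} z∈ u∈ p∈ r∈ z≢u z≢p u≢p r≢z r≢u with r ≟ p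
  ... | yes r≡p = r≡p
  ... | no r≢p  =
    ⊥-elim (no-four-corners z∈ u∈ p∈ r∈ z≢u z≢p (≢-sym r≢z) u≢p (≢-sym r≢u) (≢-sym r≢p))

  corner-avoiding : ∀ {t} → DistinctCorners faces t → ∀ z u → ∃[ q ] (q ∈ᵗ t × q ≢ z × q ≢ u)
  corner-avoiding {a , b , c} (a≢b , b≢c , a≢c) z u with avoids? a z u | avoids? b z u | avoids? c z u
  ... | inj₁ avoids | _           | _           = a , inj₁ refl , avoids
  ... | inj₂ _      | inj₁ avoids | _           = b , inj₂ (inj₁ refl) , avoids
  ... | inj₂ _      | inj₂ _      | inj₁ avoids = c , inj₂ (inj₂ refl) , avoids
  ... | inj₂ a∈     | inj₂ b∈     | inj₂ c∈     =
    ⊥-elim (no-three-distinct-in-pair a∈ b∈ c∈ a≢b b≢c a≢c)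

module _ {n : ℕ} {faces : List (Tri n)} (R : Fin n → Fin n → Set) where

  -- x, p, y, q lie in this cyclic order on a simple cycle of R, given by its four arcs:
  -- adjacent arcs meet only in their common end, opposite arcs are disjoint.
  record Interleaved (x y p q : Fin n) : Set where
    field
      A B C D  : List (Fin n)
      x⇝p      : Walk faces R x p A
      x⇝q      : Walk faces R x q B
      p⇝y      : Walk faces R p y C
      q⇝y      : Walk faces R q y D
      unique-A : Unique A
      unique-B : Unique B
      unique-C : Unique C
      unique-D : Unique D
      meet-x   : ∀ {u} → u ∈ A → u ∈ B → u ≡ x
      meet-p   : ∀ {u} → u ∈ A → u ∈ C → u ≡ p
      meet-q   : ∀ {u} → u ∈ B → u ∈ D → u ≡ q
      meet-y   : ∀ {u} → u ∈ C → u ∈ D → u ≡ y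
      apart-AD : ∀ {u} → u ∈ A → u ∉ D
      apart-BC : ∀ {u} → u ∈ B → u ∉ C

  Interleaved-sym : (∀ {p q} → R p q → R q p) → ∀ {x y p q} → Interleaved x y p q → Interleaved p q x y
  Interleaved-sym R-sym I = record
    { A = reverse A ; B = C ; C = B ; D = reverse D
    ; x⇝p = reverse-walk R-sym x⇝p ; x⇝q = p⇝y ; p⇝y = x⇝q ; q⇝y = reverse-walk R-sym q⇝y
    ; unique-A = Unique-reverse unique-A ; unique-B = unique-C
    ; unique-C = unique-B ; unique-D = Unique-reverse unique-D
    ; meet-x   = meet-p ∘ reverse⁻
    ; meet-p   = meet-x ∘ reverse⁻
    ; meet-q   = λ u∈C u∈D → meet-y u∈C (reverse⁻ u∈D)
    ; meet-y   = λ u∈B u∈D → meet-q u∈B (reverse⁻ u∈D)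
    ; apart-AD = λ u∈A u∈D → apart-AD (reverse⁻ u∈A) (reverse⁻ u∈D)
    ; apart-BC = λ u∈C u∈B → apart-BC u∈B u∈C
    }
    where open Interleaved I

  interleaved-arcs : ∀ {a b p q P Q} → Walk faces R a b P → Unique P → Walk faces R a b Q → Unique Q →
                     (∀ {u} → u ∈ P → u ∈ Q → u ≡ a ⊎ u ≡ b) → p ∈ P → q ∈ Q →
                     p ≢ a → p ≢ b → q ≢ a → q ≢ b → Interleaved a b p q
  interleaved-arcs {a} {b} wP P! wQ Q! meet p∈ q∈ p≢a p≢b q≢a q≢b = record
    { A = SP.prefix ; B = SQ.prefix ; C = SP.suffix ; D = SQ.suffix
    ; x⇝p = SP.prefix-walk ; x⇝q = SQ.prefix-walk ; p⇝y = SP.suffix-walk ; q⇝y = SQ.suffix-walk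
    ; unique-A = SP.unique-prefix P! ; unique-B = SQ.unique-prefix Q!
    ; unique-C = SP.unique-suffix P! ; unique-D = SQ.unique-suffix Q!
    ; meet-x   = meet-a
    ; meet-p   = SP.meet P!
    ; meet-q   = SQ.meet Q!
    ; meet-y   = meet-b
    ; apart-AD = λ u∈A u∈D → [ (λ { refl → a∉D u∈D }) , (λ { refl → b∉A u∈A }) ]
                               (meet (SP.prefix⊆ u∈A) (SQ.suffix⊆ u∈D))
    ; apart-BC = λ u∈B u∈C → [ (λ { refl → a∉C u∈C }) , (λ { refl → b∉B u∈B }) ]
                               (meet (SP.suffix⊆ u∈C) (SQ.prefix⊆ u∈B))
    }
    where
    module SP = Split (split wP p∈)
    module SQ = Split (split wQ q∈)

    a∉C : a ∉ SP.suffix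
    a∉C a∈C = p≢a (sym (SP.meet P! (source∈ SP.prefix-walk) a∈C))
    b∉A : b ∉ SP.prefix
    b∉A b∈A = p≢b (sym (SP.meet P! b∈A (target∈ SP.suffix-walk)))
    a∉D : a ∉ SQ.suffix
    a∉D a∈D = q≢a (sym (SQ.meet Q! (source∈ SQ.prefix-walk) a∈D))
    b∉B : b ∉ SQ.prefix
    b∉B b∈B = q≢b (sym (SQ.meet Q! b∈B (target∈ SQ.suffix-walk)))

    meet-a : ∀ {u} → u ∈ SP.prefix → u ∈ SQ.prefix → u ≡ a
    meet-a u∈A u∈B with meet (SP.prefix⊆ u∈A) (SQ.prefix⊆ u∈B)
    ... | inj₁ u≡a  = u≡a
    ... | inj₂ refl = ⊥-elim (b∉A u∈A)

    meet-b : ∀ {u} → u ∈ SP.suffix → u ∈ SQ.suffix → u ≡ b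
    meet-b u∈C u∈D with meet (SP.suffix⊆ u∈C) (SQ.suffix⊆ u∈D)
    ... | inj₁ refl = ⊥-elim (a∉C u∈C)
    ... | inj₂ u≡b  = u≡b

module Triangulation {n : ℕ} (faces : List (Tri n)) (T : IsTriangulation faces) where
  open IsTriangulation T
  open Corners faces

  infix 4 _∈ᶠ_
  _∈ᶠ_ : Fin n → FaceIx faces → Set
  x ∈ᶠ i = _∈t_ faces x (face faces i)

  Face : Fin n → Fin n → Fin n → Set
  Face = IsFace faces

  Edge : Fin n → Fin n → Set
  Edge = Adj faces

  corner-avoiding-face : ∀ i z u → ∃[ q ] (q ∈ᶠ i × q ≢ z × q ≢ u)
  corner-avoiding-face i = corner-avoiding (All.lookup corners (∈-lookup i))

  Edge-sym : ∀ {z u} → Edge z u → Edge u z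
  Edge-sym (z≢u , i , z∈ , u∈) = ≢-sym z≢u , i , u∈ , z∈

  face-swap : ∀ {z u p} → Face z u p → Face z p u
  face-swap (z≢u , u≢p , z≢p , i , z∈ , u∈ , p∈) = z≢p , ≢-sym u≢p , z≢u , i , z∈ , p∈ , u∈

  face-edge₁ : ∀ {z u p} → Face z u p → Edge z u
  face-edge₁ (z≢u , _ , _ , i , z∈ , u∈ , _) = z≢u , i , z∈ , u∈

  face-edge₂ : ∀ {z u p} → Face z u p → Edge z p
  face-edge₂ (_ , _ , z≢p , i , z∈ , _ , p∈) = z≢p , i , z∈ , p∈

  edge-face : ∀ {z u} → Edge z u → ∃[ p ] Face z u p
  edge-face {z} {u} (z≢u , i , z∈ , u∈) with corner-avoiding-face i z u
  ... | p , p∈ , p≢z , p≢u = p , z≢u , ≢-sym p≢u , ≢-sym p≢z , i , z∈ , u∈ , p∈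

  FaceStep-sym : ∀ {v x y i j} → FaceStep faces v x y i j → FaceStep faces v x y j i
  FaceStep-sym (p , q , p≢q , p∈i , q∈i , p∈j , q∈j , off) = p , q , p≢q , p∈j , q∈j , p∈i , q∈i , off

  at-most-two-apexes : ∀ {z u p q r} → Face z u p → Face z u q → Face z u r → p ≢ q → r ≡ p ⊎ r ≡ q
  at-most-two-apexes (z≢u , u≢p , z≢p , i , z∈i , u∈i , p∈i) (_ , u≢q , z≢q , j , z∈j , u∈j , q∈j)
                     (_ , u≢r , z≢r , k , z∈k , u∈k , r∈k) p≢q
    with edgeTwoFaces _ _ (z≢u , i , z∈i , u∈i)
  ... | _ , _ , _ , _ , _ , only with k ≟ i | k ≟ j
  ... | yes refl | _ = inj₁ (fourth-corner-repeats z∈i u∈i p∈i r∈k z≢u z≢p u≢p (≢-sym z≢r) (≢-sym u≢r))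
  ... | no _ | yes refl = inj₂ (fourth-corner-repeats z∈j u∈j q∈j r∈k z≢u z≢q u≢q (≢-sym z≢r) (≢-sym u≢r))
  ... | no k≢i | no k≢j =
    ⊥-elim (no-three-distinct-in-pair (only i z∈i u∈i) (only j z∈j u∈j) (only k z∈k u∈k)
                                      i≢j (≢-sym k≢j) (≢-sym k≢i))
    where
    i≢j : i ≢ j
    i≢j refl = no-four-corners z∈i u∈i p∈i q∈j z≢u z≢p z≢q u≢p u≢q p≢q

  another-apex : ∀ {z u p} → Face z u p → ∃[ q ] (q ≢ p × Face z u q)
  another-apex {z} {u} {p} (z≢u , u≢p , z≢p , i , z∈i , u∈i , p∈i)
    with edgeTwoFaces z u (z≢u , i , z∈i , u∈i)
  ... | f , g , f≢g , (z∈f , u∈f) , (z∈g , u∈g) , only = other-face (only i z∈i u∈i)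
    where
    apex-of : ∀ j → i ≢ j → z ∈ᶠ j → u ∈ᶠ j → ∃[ q ] (q ≢ p × Face z u q)
    apex-of j i≢j z∈j u∈j with corner-avoiding-face j z u
    ... | q , q∈j , q≢z , q≢u = q , q≢p , z≢u , ≢-sym q≢u , ≢-sym q≢z , j , z∈j , u∈j , q∈j
      where
      q≢p : q ≢ p
      q≢p refl = shareAtMostOneEdge i j i≢j corners-shared
        where
        corners-shared : ∀ x → x ∈ᶠ i → x ∈ᶠ j
        corners-shared x x∈i with x ≟ z | x ≟ u
        ... | yes refl | _ = z∈j
        ... | no _ | yes refl = u∈j
        ... | no x≢z | no x≢u
          rewrite fourth-corner-repeats z∈i u∈i p∈i x∈i z≢u z≢p u≢p x≢z x≢u = q∈j

    other-face : i ≡ f ⊎ i ≡ g → ∃[ q ] (q ≢ p × Face z u q)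
    other-face (inj₁ refl) = apex-of g f≢g z∈g u∈g
    other-face (inj₂ refl) = apex-of f (≢-sym f≢g) z∈f u∈f

  module LinkCycle (z : Fin n) =
    CycleGraph {faces = faces} (Face z) (Edge z) face-swap (proj₁ ∘ proj₂) face-edge₁
               at-most-two-apexes another-apex (linkConnected z _ _)

  module Separation (v x y : Fin n) (F₀ : FaceIx faces) where

    OffCycle : Fin n → Set
    OffCycle u = ¬ OnCycle faces v x y u

    off-cycle : ∀ {u} → v ≢ u → u ≢ x → u ≢ y → OffCycle u
    off-cycle v≢u _   _   (inj₁ u≡v)        = v≢u (sym u≡v)
    off-cycle _   u≢x _   (inj₂ (inj₁ u≡x)) = u≢x u≡x
    off-cycle _   _   u≢y (inj₂ (inj₂ u≡y)) = u≢y u≡y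

    on-cycle? : ∀ u → Dec (OnCycle faces v x y u)
    on-cycle? u = u ≟ v ⊎-dec u ≟ x ⊎-dec u ≟ y

    Reached : FaceIx faces → Set
    Reached = Star (FaceStep faces v x y) F₀

    ReachedAlong : Fin n → Fin n → Set
    ReachedAlong r p = ∀ i → r ∈ᶠ i → p ∈ᶠ i → Reached i

    ReachedAt : Fin n → Set
    ReachedAt r = ∀ i → r ∈ᶠ i → Reached i

    CanCross : Fin n → Fin n → Set
    CanCross r q = ∀ {i j} → Reached i → r ∈ᶠ i → q ∈ᶠ i → r ∈ᶠ j → q ∈ᶠ j → Reached j

    cross-off-cycle : ∀ {r q} → r ≢ q → OffCycle r ⊎ OffCycle q → CanCross r q
    cross-off-cycle {r} {q} r≢q off reached r∈i q∈i r∈j q∈j =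
      reached ◅◅ ((r , q , r≢q , r∈i , q∈i , r∈j , q∈j , not-both-on) ◅ ε)
      where
      not-both-on : ¬ (OnCycle faces v x y r × OnCycle faces v x y q)
      not-both-on (on-r , on-q) = [ (λ ¬on → ¬on on-r) , (λ ¬on → ¬on on-q) ] off

    cross-reached-at₁ : ∀ {r q} → ReachedAt r → CanCross r q
    cross-reached-at₁ reached-r _ _ _ r∈j _ = reached-r _ r∈j

    cross-reached-at₂ : ∀ {r q} → ReachedAt q → CanCross r q
    cross-reached-at₂ reached-q _ _ _ _ q∈j = reached-q _ q∈j

    cross-reached-along : ∀ {r q} → ReachedAlong r q → CanCross r q
    cross-reached-along reached-rq _ _ _ r∈j q∈j = reached-rq _ r∈j q∈j

    along-link : ∀ {r p q} → Face r p q → CanCross r q → ReachedAlong r p → ReachedAlong r q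
    along-link (_ , _ , _ , k , r∈k , p∈k , q∈k) cross reached-rp j r∈j q∈j =
      cross (reached-rp k r∈k p∈k) r∈k q∈k r∈j q∈j

    spread-around : ∀ {r i} → (∀ {q} → r ≢ q → CanCross r q) → Reached i → r ∈ᶠ i → ReachedAt r
    spread-around {r} {i} cross reached r∈i j r∈j with corner-avoiding-face i r r | corner-avoiding-face j r r
    ... | p , p∈i , p≢r , _ | q , q∈j , q≢r , _ =
      Star-preserves (ReachedAlong r) (λ f → along-link f (cross (proj₁ (proj₂ (proj₂ f)))))
        (linkConnected r p q (≢-sym p≢r , i , r∈i , p∈i) (≢-sym q≢r , j , r∈j , q∈j))
        (λ k r∈k p∈k → cross (≢-sym p≢r) reached r∈i p∈i r∈k p∈k) j r∈j q∈j

    around-off-cycle : ∀ {r i} → OffCycle r → Reached i → r ∈ᶠ i → ReachedAt r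
    around-off-cycle off = spread-around (λ r≢q → cross-off-cycle r≢q (inj₁ off))

    edge-reached : ∀ {z u p q} → Face z u p → Face z u q → p ≢ q →
                   ReachedAt p → ReachedAt q → ReachedAlong z u
    edge-reached {z} {u} zup zuq p≢q reached-p reached-q i z∈i u∈i with corner-avoiding-face i z u
    ... | r , r∈i , r≢z , r≢u
      with at-most-two-apexes zup zuq (proj₁ zup , ≢-sym r≢u , ≢-sym r≢z , i , z∈i , u∈i , r∈i) p≢q
    ... | inj₁ refl = reached-p i r∈i
    ... | inj₂ refl = reached-q i r∈i

    AvoidsCycleExcept : Fin n → List (Fin n) → Set
    AvoidsCycleExcept z L = ∀ {u} → u ∈ L → u ≢ z → u ≢ x × u ≢ y

    successor-reached : ∀ {z p L} → Walk faces (Face v) z p L → Unique L → AvoidsCycleExcept z L →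
                        z ≢ p → ReachedAt p → ∃[ z₁ ] (Face v z z₁ × z₁ ∈ L × ReachedAt z₁)
    successor-reached here _ _ z≢p _ = ⊥-elim (z≢p refl)
    successor-reached (step f w) (z∉ ∷ _) avoids _ reached-p =
      _ , f , there (source∈ w) , walk-reflects ReachedAt backwards w reached-p
      where
      backwards : ∀ {u r} → u ∈ _ → Face v u r → ReachedAt r → ReachedAt u
      backwards u∈ (v≢u , _ , _ , k , _ , u∈k , r∈k) reached-r
        with avoids (there u∈) (λ u≡z → All.lookup z∉ u∈ (sym u≡z))
      ... | u≢x , u≢y = around-off-cycle (off-cycle v≢u u≢x u≢y) (reached-r k r∈k) u∈k

    corner-reached : ∀ {z p q A B} → Walk faces (Face v) z p A → Walk faces (Face v) z q B →
                     Unique A → Unique B → (∀ {u} → u ∈ A → u ∈ B → u ≡ z) →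
                     AvoidsCycleExcept z A → AvoidsCycleExcept z B → z ≢ p → z ≢ q →
                     ReachedAt p → ReachedAt q → ReachedAlong v z
    corner-reached z⇝p z⇝q A! B! meet avoids-A avoids-B z≢p z≢q reached-p reached-q
      with successor-reached z⇝p A! avoids-A z≢p reached-p | successor-reached z⇝q B! avoids-B z≢q reached-q
    ... | z₁ , f₁ , z₁∈A , reached-z₁ | z₂ , f₂ , z₂∈B , reached-z₂ =
      edge-reached f₁ f₂ z₁≢z₂ reached-z₁ reached-z₂
      where
      z₁≢z₂ : z₁ ≢ z₂
      z₁≢z₂ refl = proj₁ (proj₂ f₁) (sym (meet z₁∈A z₂∈B))

    module _ (tc : ThreeCycle faces v x y) (reached-vx : ReachedAlong v x) (reached-vy : ReachedAlong v y) where

      reached-at-v : ReachedAt v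
      reached-at-v with edge-face (proj₁ tc)
      ... | _ , (_ , _ , _ , k , v∈k , x∈k , _) = spread-around cross-at-v (reached-vx k v∈k x∈k) v∈k
        where
        cross-at-v : ∀ {q} → v ≢ q → CanCross v q
        cross-at-v {q} v≢q with on-cycle? q
        ... | no off                 = cross-off-cycle v≢q (inj₂ off)
        ... | yes (inj₁ refl)        = ⊥-elim (v≢q refl)
        ... | yes (inj₂ (inj₁ refl)) = cross-reached-along reached-vx
        ... | yes (inj₂ (inj₂ refl)) = cross-reached-along reached-vy

      -- Around x we may not cross xy yet, so we walk around lk(x) avoiding y.
      reached-at-x : ReachedAt x
      reached-at-x j x∈j with corner-avoiding-face j x y | edge-face (proj₁ (proj₂ tc))
      ... | q , q∈j , q≢x , q≢y | _ , xyy₁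
        with LinkCycle.avoiding-walk x xyy₁ (Edge-sym (proj₁ tc)) (≢-sym q≢x , j , x∈j , q∈j)
                                     (proj₁ (proj₂ (proj₂ tc))) q≢y
      ... | L , v⇝q , y∉L =
        walk-preserves (ReachedAlong x) cross-step v⇝q (λ i _ v∈i → reached-at-v i v∈i) j x∈j q∈j
        where
        cross-at-x : ∀ {r} → x ≢ r → r ≢ y → CanCross x r
        cross-at-x {r} x≢r r≢y with r ≟ v
        ... | yes refl = cross-reached-at₂ reached-at-v
        ... | no r≢v   = cross-off-cycle x≢r (inj₂ (off-cycle (≢-sym r≢v) (≢-sym x≢r) r≢y))

        cross-step : ∀ {p r} → r ∈ L → Face x p r → ReachedAlong x p → ReachedAlong x r
        cross-step r∈ f = along-link f (cross-at-x (proj₁ (proj₂ (proj₂ f))) (λ { refl → y∉L r∈ }))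

      cross-any : ∀ {r q} → r ≢ q → CanCross r q
      cross-any {r} {q} r≢q with on-cycle? r | on-cycle? q
      ... | no off | _      = cross-off-cycle r≢q (inj₁ off)
      ... | yes _  | no off = cross-off-cycle r≢q (inj₂ off)
      ... | yes (inj₁ refl)        | yes _                  = cross-reached-at₁ reached-at-v
      ... | yes (inj₂ (inj₁ refl)) | yes _                  = cross-reached-at₁ reached-at-x
      ... | yes (inj₂ (inj₂ refl)) | yes (inj₁ refl)        = cross-reached-at₂ reached-at-v
      ... | yes (inj₂ (inj₂ refl)) | yes (inj₂ (inj₁ refl)) = cross-reached-at₂ reached-at-x
      ... | yes (inj₂ (inj₂ refl)) | yes (inj₂ (inj₂ refl)) = ⊥-elim (r≢q refl)

      reached-everywhere : ∀ i → Reached i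
      reached-everywhere i =
        Star-preserves ReachedAt reached-at-neighbour (connected v (proj₁ (face faces i))) reached-at-v
                       i (inj₁ refl)
        where
        reached-at-neighbour : ∀ {p r} → Edge p r → ReachedAt p → ReachedAt r
        reached-at-neighbour (_ , k , p∈k , r∈k) reached-p = spread-around cross-any (reached-p k p∈k) r∈k

      nonseparating : NonseparatingThreeCycle faces v x y
      nonseparating = tc , λ i j → Star.reverse FaceStep-sym (reached-everywhere i) ◅◅ reached-everywhere j

  interleaved-nonseparating : ∀ {v x y p q} → ThreeCycle faces v x y → ThreeCycle faces v p q →
                              Interleaved (Face v) x y p q → NonseparatingThreeCycle faces v x y
  interleaved-nonseparating {v} {x} {y} {p} {q} vxy ((v≢p , _) , (_ , k , p∈k , q∈k) , (v≢q , _)) I =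
    nonseparating vxy reached-vx reached-vy
    where
    open Interleaved I
    open Separation v x y k

    x∉C : x ∉ C
    x∉C = apart-BC (source∈ x⇝q)
    x∉D : x ∉ D
    x∉D = apart-AD (source∈ x⇝p)
    y∉A : y ∉ A
    y∉A y∈A = apart-AD y∈A (target∈ q⇝y)
    y∉B : y ∉ B
    y∉B y∈B = apart-BC y∈B (target∈ p⇝y)

    avoids-x : ∀ {L} → y ∉ L → AvoidsCycleExcept x L
    avoids-x y∉L u∈L u≢x = u≢x , λ { refl → y∉L u∈L }
    avoids-y : ∀ {L} → x ∉ L → AvoidsCycleExcept y L
    avoids-y x∉L u∈L u≢y = (λ { refl → x∉L u∈L }) , u≢y

    ∈-∉-distinct : ∀ {u w L} → u ∈ L → w ∉ L → u ≢ w
    ∈-∉-distinct u∈L w∉L refl = w∉L u∈L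

    p≢x : p ≢ x
    p≢x = ∈-∉-distinct (source∈ p⇝y) x∉C
    p≢y : p ≢ y
    p≢y = ∈-∉-distinct (target∈ x⇝p) y∉A
    q≢x : q ≢ x
    q≢x = ∈-∉-distinct (source∈ q⇝y) x∉D
    q≢y : q ≢ y
    q≢y = ∈-∉-distinct (target∈ x⇝q) y∉B

    reached-p : ReachedAt p
    reached-p = around-off-cycle (off-cycle v≢p p≢x p≢y) ε p∈k
    reached-q : ReachedAt q
    reached-q = around-off-cycle (off-cycle v≢q q≢x q≢y) ε q∈k

    reached-vx : ReachedAlong v x
    reached-vx = corner-reached x⇝p x⇝q unique-A unique-B meet-x (avoids-x y∉A) (avoids-x y∉B)
                   (≢-sym p≢x) (≢-sym q≢x) reached-p reached-q

    reached-vy : ReachedAlong v y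
    reached-vy = corner-reached (reverse-walk face-swap p⇝y) (reverse-walk face-swap q⇝y)
                   (Unique-reverse unique-C) (Unique-reverse unique-D)
                   (λ u∈C u∈D → meet-y (reverse⁻ u∈C) (reverse⁻ u∈D))
                   (avoids-y (x∉C ∘ reverse⁻)) (avoids-y (x∉D ∘ reverse⁻))
                   (≢-sym p≢y) (≢-sym q≢y) reached-p reached-q

  CrossingNonseparatingTriangles : Fin n → Set
  CrossingNonseparatingTriangles v =
    ∃[ vi ] ∃[ vj ] ∃[ vk ] ∃[ vl ]
      (NonseparatingThreeCycle faces v vi vk ×
       NonseparatingThreeCycle faces v vj vl ×
       (vi ≢ vj × vi ≢ vk × vi ≢ vl × vj ≢ vk × vj ≢ vl × vk ≢ vl) ×
       ∃[ P ] ∃[ Q ]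
         (LinkPath faces v vi vk P × LinkPath faces v vi vk Q ×
          (∀ x → x ∈ P → x ∈ Q → x ≡ vi ⊎ x ≡ vk) ×
          vj ∈ P × vl ∈ Q))

  crossing-chord : ∀ {v a b p q P Q} → ThreeCycle faces v a b → ThreeCycle faces v p q →
                   Walk faces (Face v) a b P → Unique P → Walk faces (Face v) a b Q → Unique Q →
                   (∀ {u} → u ∈ P → u ∈ Q → u ≡ a ⊎ u ≡ b) → p ∈ P → q ∈ Q →
                   p ≢ a → p ≢ b → q ≢ a → q ≢ b → CrossingNonseparatingTriangles v
  crossing-chord {a = a} {b} {p} {q} vab vpq a⇝b P! a⇝′b Q! meet p∈P q∈Q p≢a p≢b q≢a q≢b =
    a , p , b , q ,
    interleaved-nonseparating vab vpq I ,
    interleaved-nonseparating vpq vab (Interleaved-sym (Face _) face-swap I) ,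
    (≢-sym p≢a , proj₁ (proj₁ (proj₂ vab)) , ≢-sym q≢a ,
     p≢b , proj₁ (proj₁ (proj₂ vpq)) , ≢-sym q≢b) ,
    _ , _ , (a⇝b , P!) , (a⇝′b , Q!) , (λ _ → meet) , p∈P , q∈Q
    where
    I : Interleaved (Face _) a b p q
    I = interleaved-arcs (Face _) a⇝b P! a⇝′b Q! meet p∈P q∈Q p≢a p≢b q≢a q≢b

  module _ (irreducible : Irreducible faces) (v : Fin n) where

    crossing-from-arc : ∀ (k : ℕ) {a b L} → Walk faces (Face v) a b L → Unique L → length L ≤ k →
                      ThreeCycle faces v a b → ¬ Face v a b → CrossingNonseparatingTriangles v
    crossing-from-arc k here _ _ (_ , (a≢b , _) , _) _ = ⊥-elim (a≢b refl)
    crossing-from-arc zero (step _ _) _ () _ _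
    crossing-from-arc (suc k) {a} {b} (step {z = w} f w⇝b) L!@(_ ∷ W!) (s≤s length≤) vab ¬vab
      with irreducible v w (face-edge₂ f)
    ... | c , vc , wc , ¬vwc with any? (c ≟_) _
    ... | yes c∈W = crossing-from-arc k S.prefix-walk (S.unique-prefix W!) (≤-trans S.prefix-length length≤)
                                    (face-edge₂ f , wc , vc) ¬vwc
      where module S = Split (split w⇝b c∈W)
    ... | no c∉W with LinkCycle.complementary-arc v (step f w⇝b) L! (proj₁ (proj₁ (proj₂ vab)))
    ... | _ , a⇝′b , Q! , meet , covers =
      crossing-chord vab (face-edge₂ f , wc , vc) (step f w⇝b) L! a⇝′b Q! meet (there (source∈ w⇝b)) c∈Q
                     (≢-sym (proj₁ (proj₂ f))) w≢b c≢a c≢b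
      where
      c≢a : c ≢ a
      c≢a refl = ¬vwc (face-swap f)
      c≢b : c ≢ b
      c≢b refl = c∉W (target∈ w⇝b)
      w≢b : w ≢ b
      w≢b refl = ¬vab f
      c∈Q : c ∈ _
      c∈Q with covers vc
      ... | inj₁ (here c≡a) = ⊥-elim (c≢a c≡a)
      ... | inj₁ (there c∈W) = ⊥-elim (c∉W c∈W)
      ... | inj₂ c∈Q = c∈Q

    crossing-at : CrossingNonseparatingTriangles v
    crossing-at with vertexUsed v
    ... | i , v∈i with corner-avoiding-face i v v
    ... | a , a∈i , a≢v , _ = from-edge (≢-sym a≢v , i , v∈i , a∈i)
      where
      from-edge : Edge v a → CrossingNonseparatingTriangles v
      from-edge va with irreducible v a va
      ... | b , vb , ab , ¬vab with loop-erase (linkConnected v a b va vb)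
      ... | L , a⇝b , L! = crossing-from-arc (length L) a⇝b L! ≤-refl (va , ab , vb) ¬vab

theorem4p1 : (n : ℕ) (faces : List (Tri n)) →
    IsTriangulation faces → NotSphere faces → Irreducible faces →
    (v : Fin n) →
    ∃[ vi ] ∃[ vj ] ∃[ vk ] ∃[ vl ]
      (NonseparatingThreeCycle faces v vi vk ×
       NonseparatingThreeCycle faces v vj vl ×
       (vi ≢ vj × vi ≢ vk × vi ≢ vl × vj ≢ vk × vj ≢ vl × vk ≢ vl) ×
       ∃[ P ] ∃[ Q ]
         (LinkPath faces v vi vk P × LinkPath faces v vi vk Q ×
          (∀ x → x ∈ P → x ∈ Q → x ≡ vi ⊎ x ≡ vk) ×
          vj ∈ P × vl ∈ Q))
theorem4p1 n faces T _ irreducible v = Triangulation.crossing-at faces T irreducible v
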